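{- Let $\langle\mathcal{M},\mathcal{E}\rangle$ be a constrained equational theory, $X\subseteq\mathcal{V}_{th}$ a set of theory variables, $s,t\in\mathcal{T}(\mathcal{F}_{th},X)$, and $\varphi$ a logical constraint with $\mathrm{Var}(\varphi)\subseteq X$. If $\models_\mathcal{M}(\varphi\sigma\Rightarrow s\sigma=t\sigma)$ holds for all $X$-valued substitutions $\sigma$, then $\mathcal{E}\models_{\mathrm{cec}}\Pi X.\ s\approx t\ [\varphi]$.
   Context: Signature: sorts $\mathcal{S} = \mathcal{S}_{th} \uplus \mathcal{S}_{te}$ (theory/term sorts), function symbols $\mathcal{F} = \mathcal{F}_{th} \uplus \mathcal{F}_{te}$ with sort declarations; theory symbols have only theory sorts. Sorted variables $\mathcal{V} = \mathcal{V}_{th}\uplus\mathcal{V}_{te}$. A model $\mathcal{M} = \langle \mathcal{I},\mathcal{J}\rangle$ assigns a non-empty set $\mathcal{I}(\tau)$ to each theory sort and a function $\mathcal{J}(f)$ to each $f \in\mathcal{F}_{th}$; for each theory sort $\tau$ a set $\mathrm{Val}_\tau\subseteq\mathcal{F}_{th}$ of constants ("values") is mapped bijectively onto $\mathcal{I}(\tau)$ by $\mathcal{J}$; $\mathrm{Val}=\bigcup_\tau\mathrm{Val}_\tau$. Sort $\mathsf{Bool}$ with $\mathcal{I}(\mathsf{Bool})=\{\mathsf{true},\mathsf{false}\}$, standard connectives and equality symbols $=$. Logical constraints: terms of $\mathcal{T}(\mathcal{F}_{th},\mathcal{V})$ of sort $\mathsf{Bool}$; $\models_\mathcal{M}\varphi$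 means true under every valuation. Substitutions: sort-preserving, finite domain; $\mathcal{V}\mathrm{Dom}(\sigma)=\{x\in\mathrm{Dom}(\sigma)\mid\sigma(x)\in\mathrm{Val}\}$; $\sigma$ is $X$-valued if $X\subseteq\mathcal{V}\mathrm{Dom}(\sigma)$. Calculation step $s\to_{calc}t$: $s=C[f(c_1,\dots,c_n)]$, $t=C[c_0]$, $f\in\mathcal{F}_{th}\setminus\mathrm{Val}$, $c_i\in\mathrm{Val}$, $c_0=\mathcal{J}(f)(c_1,\dots,c_n)$; $\leftrightarrow_{calc}$ its symmetric closure. A CE $\Pi X.\ s\approx t\ [\varphi]$: terms of equal sort, logical constraint $\varphi$, $X\subseteq\mathcal{V}_{th}$ with $\mathrm{Var}(\varphi)\subseteq X$. Theory $\langle\mathcal{M},\mathcal{E}\rangle$: $\mathcal{E}$ a set of CEs. $s\leftrightarrow_{rule,\mathcal{E}}t$ iff $s=C[\ell\sigma]$, $t=C[r\sigma]$ (or vice versa) for some $\Pi X.\ \ell\approx r\ [\varphi]\in\mathcal{E}$ and $X$-valued $\sigma$ with $\models_\mathcal{M}\varphi\sigma$; $\leftrightarrow_\mathcal{E}=\leftrightarrow_{calc}\cup\leftrightarrow_{rule,\mathcal{E}}$. $\mathcal{E}\models_{\mathrm{cec}}\Pi X.\ s\approx t\ [\varphi]$ iff $s\sigma\leftrightarrow^*_\mathcal{E}t\sigma$ for all $X$-valued $\sigma$ with $\models_\mathcal{M}\varphi\sigma$. -}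

module Defs where

open import Data.List using (List; []; _∷_)
open import Data.List.Relation.Unary.All using (All; []; _∷_)
open import Data.List.Membership.Propositional using (_∈_)
open import Data.Sum using (_⊎_; inj₁; inj₂)
open import Data.Product using (Σ; _×_; _,_; proj₁; proj₂)
open import Data.Bool using (Bool; true; false; not; _∨_)
open import Data.Empty using (⊥)
open import Relation.Nullary using (¬_)
open import Relation.Binary.PropositionalEquality using (_≡_)
open import Relation.Binary.Construct.Closure.ReflexiveTransitive using (Star)
open import Function.Bundles using (_↔_; _⇔_; Inverse)
open import Function.Definitions using (Bijective)

record Signature : Set₁ where
  field
    STh  : Set
    STe  : Set
    𝔹    : STh
    FTh  : List STh → STh → Set
    FTe  : List (STh ⊎ STe) → (STh ⊎ STe) → Set
    V    : STh ⊎ STe → Set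
    impF : FTh (𝔹 ∷ 𝔹 ∷ []) 𝔹
    eqF  : (τ : STh) → FTh (τ ∷ τ ∷ []) 𝔹

  Sort : Set
  Sort = STh ⊎ STe

record Model (S : Signature) : Set₁ where
  open Signature S
  field
    I        : STh → Set
    nonempty : (τ : STh) → I τ
    J        : ∀ {as τ} → FTh as τ → All I as → I τ
    -- Val_τ ⊆ F_th : a (decidable, proof-irrelevant) subset of the constants of sort τ
    isVal    : (τ : STh) → FTh [] τ → Bool
    val-bij  : (τ : STh) →
               Bijective _≡_ _≡_ (λ (c : Σ (FTh [] τ) (λ c → isVal τ c ≡ true)) → J (proj₁ c) [])
    bool     : I 𝔹 ↔ Bool
    impF-sem : (a b : I 𝔹) →
               Inverse.to bool (J impF (a ∷ b ∷ [])) ≡ (not (Inverse.to bool a) ∨ Inverse.to bool b)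
    eqF-sem  : (τ : STh) (a b : I τ) →
               (Inverse.to bool (J (eqF τ) (a ∷ b ∷ [])) ≡ true) ⇔ (a ≡ b)

module Th {S : Signature} (M : Model S) where
  open Signature S public
  open Model M public

  Val : (τ : STh) → FTh [] τ → Set
  Val τ c = isVal τ c ≡ true

  IsValSym : ∀ {as τ} → FTh as τ → Set
  IsValSym {[]}    {τ} f = Val τ f
  IsValSym {_ ∷ _}     f = ⊥

  mutual
    data Term : Sort → Set where
      var : ∀ {s} → V s → Term s
      th  : ∀ {as τ} → FTh as τ → TArgs as → Term (inj₁ τ)
      te  : ∀ {as s} → FTe as s → Args as → Term s

    data TArgs : List STh → Set where
      []  : TArgs []
      _∷_ : ∀ {τ as} → Term (inj₁ τ) → TArgs as → TArgs (τ ∷ as)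

    data Args : List Sort → Set where
      []  : Args []
      _∷_ : ∀ {s as} → Term s → Args as → Args (s ∷ as)

  VTh : STh → Set
  VTh τ = V (inj₁ τ)

  VSet : Set₁
  VSet = ∀ {τ} → VTh τ → Set

  mutual
    data ThTerm : STh → Set where
      var : ∀ {τ} → VTh τ → ThTerm τ
      app : ∀ {as τ} → FTh as τ → ThArgs as → ThTerm τ

    data ThArgs : List STh → Set where
      []  : ThArgs []
      _∷_ : ∀ {τ as} → ThTerm τ → ThArgs as → ThArgs (τ ∷ as)

  mutual
    ⌜_⌝ : ∀ {τ} → ThTerm τ → Term (inj₁ τ)
    ⌜ var x ⌝    = var x
    ⌜ app f ts ⌝ = th f ⌜ ts ⌝*

    ⌜_⌝* : ∀ {as} → ThArgs as → TArgs as
    ⌜ [] ⌝*     = []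
    ⌜ t ∷ ts ⌝* = ⌜ t ⌝ ∷ ⌜ ts ⌝*

  mutual
    data Occ {τ′} (x : VTh τ′) : ∀ {τ} → ThTerm τ → Set where
      here : Occ x (var x)
      arg  : ∀ {as τ} {f : FTh as τ} {ts} → OccArgs x ts → Occ x (app f ts)

    data OccArgs {τ′} (x : VTh τ′) : ∀ {as} → ThArgs as → Set where
      head : ∀ {τ as} {t : ThTerm τ} {ts : ThArgs as} → Occ x t → OccArgs x (t ∷ ts)
      tail : ∀ {τ as} {t : ThTerm τ} {ts : ThArgs as} → OccArgs x ts → OccArgs x (t ∷ ts)

  _⊆V_ : ∀ {τ} → ThTerm τ → VSet → Set
  t ⊆V X = ∀ {τ′} (x : VTh τ′) → Occ x t → X x

  Constraint : Set
  Constraint = ThTerm 𝔹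

  Valuation : Set
  Valuation = ∀ {τ} → VTh τ → I τ

  mutual
    ⟦_⟧ : ∀ {τ} → ThTerm τ → Valuation → I τ
    ⟦ var x ⟧    ρ = ρ x
    ⟦ app f ts ⟧ ρ = J f (⟦ ts ⟧* ρ)

    ⟦_⟧* : ∀ {as} → ThArgs as → Valuation → All I as
    ⟦ [] ⟧*     ρ = []
    ⟦ t ∷ ts ⟧* ρ = ⟦ t ⟧ ρ ∷ ⟦ ts ⟧* ρ

  ⊨ : Term (inj₁ 𝔹) → Set
  ⊨ t = Σ Constraint (λ u → (⌜ u ⌝ ≡ t) × (∀ (ρ : Valuation) → Inverse.to bool (⟦ u ⟧ ρ) ≡ true))

  _⇒ₜ_ : Term (inj₁ 𝔹) → Term (inj₁ 𝔹) → Term (inj₁ 𝔹)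
  φ ⇒ₜ ψ = th impF (φ ∷ ψ ∷ [])

  _=ₜ_ : ∀ {τ} → Term (inj₁ τ) → Term (inj₁ τ) → Term (inj₁ 𝔹)
  _=ₜ_ {τ} u v = th (eqF τ) (u ∷ v ∷ [])

  record Subst : Set where
    field
      apply  : ∀ {s} → V s → Term s
      dom    : List (Σ Sort V)
      finite : ∀ {s} (x : V s) → ¬ (apply x ≡ var x) → (s , x) ∈ dom
  open Subst public

  mutual
    _⟨_⟩ : ∀ {s} → Term s → Subst → Term s
    var x   ⟨ σ ⟩ = apply σ x
    th f ts ⟨ σ ⟩ = th f (ts ⟨ σ ⟩ᵗ)
    te f ts ⟨ σ ⟩ = te f (ts ⟨ σ ⟩ᵃ)

    _⟨_⟩ᵗ : ∀ {as} → TArgs as → Subst → TArgs as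
    []       ⟨ σ ⟩ᵗ = []
    (t ∷ ts) ⟨ σ ⟩ᵗ = (t ⟨ σ ⟩) ∷ (ts ⟨ σ ⟩ᵗ)

    _⟨_⟩ᵃ : ∀ {as} → Args as → Subst → Args as
    []       ⟨ σ ⟩ᵃ = []
    (t ∷ ts) ⟨ σ ⟩ᵃ = (t ⟨ σ ⟩) ∷ (ts ⟨ σ ⟩ᵃ)

  IsValue : ∀ {τ} → Term (inj₁ τ) → Set
  IsValue {τ} t = Σ (FTh [] τ) (λ c → Val τ c × (t ≡ th c []))

  _∈VDom_ : ∀ {τ} → VTh τ → Subst → Set
  x ∈VDom σ = ¬ (apply σ x ≡ var x) × IsValue (apply σ x)

  _Valued_ : VSet → Subst → Set
  X Valued σ = ∀ {τ} (x : VTh τ) → X x → x ∈VDom σ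

  ValList : List STh → Set
  ValList as = All (λ τ → Σ (FTh [] τ) (Val τ)) as

  valArgs : ∀ {as} → ValList as → TArgs as
  valArgs []             = []
  valArgs ((c , _) ∷ cs) = th c [] ∷ valArgs cs

  valInterp : ∀ {as} → ValList as → All I as
  valInterp []             = []
  valInterp ((c , _) ∷ cs) = J c [] ∷ valInterp cs

  TRel : Set₂
  TRel = ∀ {s} → Term s → Term s → Set₁

  data CalcRoot : ∀ {s} → Term s → Term s → Set₁ where
    calc : ∀ {as τ} (f : FTh as τ) → ¬ IsValSym f → (cs : ValList as)
           (c₀ : FTh [] τ) → Val τ c₀ → J c₀ [] ≡ J f (valInterp cs) →
           CalcRoot (th f (valArgs cs)) (th c₀ [])

  mutual
    data Ctx (R : TRel) : ∀ {s} → Term s → Term s → Set₁ where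
      root : ∀ {s} {u v : Term s} → R u v → Ctx R u v
      inTh : ∀ {as τ} (f : FTh as τ) {us vs : TArgs as} → CtxT R us vs → Ctx R (th f us) (th f vs)
      inTe : ∀ {as s} (f : FTe as s) {us vs : Args as} → CtxA R us vs → Ctx R (te f us) (te f vs)

    data CtxT (R : TRel) : ∀ {as} → TArgs as → TArgs as → Set₁ where
      here  : ∀ {τ as} {u v : Term (inj₁ τ)} {us : TArgs as} → Ctx R u v → CtxT R (u ∷ us) (v ∷ us)
      there : ∀ {τ as} {u : Term (inj₁ τ)} {us vs : TArgs as} → CtxT R us vs → CtxT R (u ∷ us) (u ∷ vs)

    data CtxA (R : TRel) : ∀ {as} → Args as → Args as → Set₁ where
      here  : ∀ {s as} {u v : Term s} {us : Args as} → Ctx R u v → CtxA R (u ∷ us) (v ∷ us)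
      there : ∀ {s as} {u : Term s} {us vs : Args as} → CtxA R us vs → CtxA R (u ∷ us) (u ∷ vs)

  Sym : TRel → TRel
  Sym R u v = R u v ⊎ R v u

  record CE : Set₁ where
    constructor Π_∙_≈_[_]⟨_⟩
    field
      {sort} : Sort
      X      : VSet
      lhs    : Term sort
      rhs    : Term sort
      φ      : Constraint
      φ⊆X    : φ ⊆V X

  data RuleRoot (E : CE → Set) : ∀ {s} → Term s → Term s → Set₁ where
    rule : (e : CE) → E e → (σ : Subst) → CE.X e Valued σ →
           ⊨ (⌜ CE.φ e ⌝ ⟨ σ ⟩) →
           RuleRoot E (CE.lhs e ⟨ σ ⟩) (CE.rhs e ⟨ σ ⟩)

  _↔calc_ : TRel
  _↔calc_ = Sym (Ctx CalcRoot)

  _↔rule[_]_ : ∀ {s} → Term s → (CE → Set) → Term s → Set₁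
  u ↔rule[ E ] v = Sym (Ctx (RuleRoot E)) u v

  _↔[_]_ : ∀ {s} → Term s → (CE → Set) → Term s → Set₁
  u ↔[ E ] v = (u ↔calc v) ⊎ (u ↔rule[ E ] v)

  _↔*[_]_ : ∀ {s} → Term s → (CE → Set) → Term s → Set₁
  u ↔*[ E ] v = Star (λ a b → a ↔[ E ] b) u v

  _⊨cec_ : (CE → Set) → CE → Set₁
  E ⊨cec e = ∀ (σ : Subst) → CE.X e Valued σ → ⊨ (⌜ CE.φ e ⌝ ⟨ σ ⟩) →
             (CE.lhs e ⟨ σ ⟩) ↔*[ E ] (CE.rhs e ⟨ σ ⟩)

-- Every variable of s and t is instantiated by σ with a value, so sσ and tσ are ground
-- theory terms. A ground theory term calculates bottom-up to the value denoting its
-- interpretation, and the validity hypothesis (applied to ⊨ φσ) says that sσ and tσ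
-- have the same interpretation; as values denote distinct elements, sσ and tσ calculate
-- to the same value and are therefore ↔calc-convertible.
module Submission where

open import Defs
open import Data.List using ([]; _∷_)
open import Data.List.Relation.Unary.All as All using (All; []; _∷_)
open import Data.Sum as Sum using (inj₁; swap)
open import Data.Product using (Σ; ∃; ∃₂; _×_; _,_; proj₁; proj₂)
open import Data.Bool using (true; false; not; _∨_)
open import Data.Bool.Properties using (not-¬)
open import Data.Empty using (⊥-elim)
open import Relation.Nullary using (¬_)
open import Relation.Binary.PropositionalEquality using (_≡_; refl; sym; trans; cong; cong₂; subst; subst₂)
open import Relation.Binary.Construct.Closure.ReflexiveTransitive as Star using (Star; ε; _◅◅_; gmap; return; reverse)
open import Function.Bundles using (Equivalence)

module CalculationLemmas {S : Signature} (M : Model S) where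
  open Th M

  ∷-injective : ∀ {τ as} {u v : Term (inj₁ τ)} {us vs : TArgs as} →
                (u ∷ us) ≡ (v ∷ vs) → u ≡ v × us ≡ vs
  ∷-injective refl = refl , refl

  ⌜⌝≡th⇒app : ∀ {as τ} {f : FTh as τ} {ts : TArgs as} (u : ThTerm τ) → ⌜ u ⌝ ≡ th f ts →
              ∃ λ us → u ≡ app f us × ⌜ us ⌝* ≡ ts
  ⌜⌝≡th⇒app (app f us) refl = us , refl , refl

  ⌜⌝≡th₂⇒app : ∀ {τ₁ τ₂ τ} {f : FTh (τ₁ ∷ τ₂ ∷ []) τ} {A B} (u : ThTerm τ) →
               ⌜ u ⌝ ≡ th f (A ∷ B ∷ []) →
               ∃₂ λ a b → u ≡ app f (a ∷ b ∷ []) × ⌜ a ⌝ ≡ A × ⌜ b ⌝ ≡ B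
  ⌜⌝≡th₂⇒app u eq with ⌜⌝≡th⇒app u eq
  ... | a ∷ b ∷ [] , refl , refl = a , b , refl , refl , refl

  mutual
    ⌜⌝-injective : ∀ {τ} (u v : ThTerm τ) → ⌜ u ⌝ ≡ ⌜ v ⌝ → u ≡ v
    ⌜⌝-injective (var x)    (var .x) refl = refl
    ⌜⌝-injective (app f us) v        eq with ⌜⌝≡th⇒app v (sym eq)
    ... | vs , refl , ⌜vs⌝≡⌜us⌝ = cong (app f) (⌜⌝*-injective us vs (sym ⌜vs⌝≡⌜us⌝))

    ⌜⌝*-injective : ∀ {as} (us vs : ThArgs as) → ⌜ us ⌝* ≡ ⌜ vs ⌝* → us ≡ vs
    ⌜⌝*-injective []       []       _  = refl
    ⌜⌝*-injective (u ∷ us) (v ∷ vs) eq =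
      cong₂ _∷_ (⌜⌝-injective u v (proj₁ (∷-injective eq)))
                (⌜⌝*-injective us vs (proj₂ (∷-injective eq)))

  ∨-not-true : ∀ {a b} → a ≡ true → not a ∨ b ≡ true → b ≡ true
  ∨-not-true refl b≡true = b≡true

  ⊨-⇒-elim : ∀ {A B} → ⊨ (A ⇒ₜ B) → ⊨ A → ⊨ B
  ⊨-⇒-elim (u , ⌜u⌝≡A⇒B , u-valid) (a′ , ⌜a′⌝≡A , a′-valid)
    with ⌜⌝≡th₂⇒app u ⌜u⌝≡A⇒B
  ... | a , b , refl , ⌜a⌝≡A , ⌜b⌝≡B with ⌜⌝-injective a a′ (trans ⌜a⌝≡A (sym ⌜a′⌝≡A))
  ... | refl = b , ⌜b⌝≡B , λ (ρ : Valuation) →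
    ∨-not-true (a′-valid ρ) (trans (sym (impF-sem (⟦ a ⟧ ρ) (⟦ b ⟧ ρ))) (u-valid ρ))

  ⊨-=-elim : ∀ {τ} {A B : Term (inj₁ τ)} → ⊨ (A =ₜ B) →
             ∃₂ λ a b → ⌜ a ⌝ ≡ A × ⌜ b ⌝ ≡ B × (∀ (ρ : Valuation) → ⟦ a ⟧ ρ ≡ ⟦ b ⟧ ρ)
  ⊨-=-elim {τ} (u , ⌜u⌝≡A=B , u-valid) with ⌜⌝≡th₂⇒app u ⌜u⌝≡A=B
  ... | a , b , refl , ⌜a⌝≡A , ⌜b⌝≡B =
    a , b , ⌜a⌝≡A , ⌜b⌝≡B , λ (ρ : Valuation) → Equivalence.to (eqF-sem τ (⟦ a ⟧ ρ) (⟦ b ⟧ ρ)) (u-valid ρ)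

  someValuation : Valuation
  someValuation {τ} _ = nonempty τ

  valueOf : ∀ {τ} → I τ → Σ (FTh [] τ) (Val τ)
  valueOf {τ} y = proj₁ (proj₂ (val-bij τ) y)

  valueOf-denotes : ∀ {τ} (y : I τ) → J (proj₁ (valueOf y)) [] ≡ y
  valueOf-denotes {τ} y = proj₂ (proj₂ (val-bij τ) y) refl

  valueOf-value : ∀ {τ} {c : FTh [] τ} → Val τ c → proj₁ (valueOf (J c [])) ≡ c
  valueOf-value {τ} {c} c∈Val = cong proj₁ (proj₁ (val-bij τ) {valueOf (J c [])} {c , c∈Val} (valueOf-denotes (J c [])))

  ⌞_⌟ : ∀ {τ} → I τ → Term (inj₁ τ)
  ⌞ y ⌟ = th (proj₁ (valueOf y)) []

  ⌞_⌟* : ∀ {as} → All I as → TArgs as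
  ⌞ ys ⌟* = valArgs (All.map valueOf ys)

  valInterp-valueOf : ∀ {as} (ys : All I as) → valInterp (All.map valueOf ys) ≡ ys
  valInterp-valueOf []       = refl
  valInterp-valueOf (y ∷ ys) = cong₂ _∷_ (valueOf-denotes y) (valInterp-valueOf ys)

  _↔*calc_ : ∀ {s} → Term s → Term s → Set₁
  u ↔*calc v = Star _↔calc_ u v

  _↔calcᵗ_ : ∀ {as} → TArgs as → TArgs as → Set₁
  us ↔calcᵗ vs = CtxT CalcRoot us vs Sum.⊎ CtxT CalcRoot vs us

  th-cong : ∀ {as τ} (f : FTh as τ) {us vs : TArgs as} →
            Star _↔calcᵗ_ us vs → th f us ↔*calc th f vs
  th-cong f = gmap (th f) (Sum.map (inTh f) (inTh f))

  ∷-congˡ : ∀ {τ as} {u v : Term (inj₁ τ)} (us : TArgs as) →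
            u ↔*calc v → Star _↔calcᵗ_ (u ∷ us) (v ∷ us)
  ∷-congˡ us = gmap (_∷ us) (Sum.map here here)

  ∷-congʳ : ∀ {τ as} (u : Term (inj₁ τ)) {us vs : TArgs as} →
            Star _↔calcᵗ_ us vs → Star _↔calcᵗ_ (u ∷ us) (u ∷ vs)
  ∷-congʳ u = gmap (u ∷_) (Sum.map there there)

  calc-root : ∀ {as τ} (f : FTh as τ) → ¬ IsValSym f → (ys : All I as) →
              th f ⌞ ys ⌟* ↔calc ⌞ J f ys ⌟
  calc-root f f∉Val ys = inj₁ (root (calc f f∉Val (All.map valueOf ys) _ (proj₂ (valueOf (J f ys)))
    (trans (valueOf-denotes (J f ys)) (cong (J f) (sym (valInterp-valueOf ys))))))

  -- A value constant is its own value; any other symbol takes one root calculation step.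
  calculate : ∀ {as τ} (f : FTh as τ) (ys : All I as) → th f ⌞ ys ⌟* ↔*calc ⌞ J f ys ⌟
  calculate {[]} {τ} f [] with isVal τ f in isVal-f
  ... | true  rewrite valueOf-value isVal-f = ε
  ... | false = return (calc-root f (not-¬ isVal-f) [])
  calculate {_ ∷ _} f ys = return (calc-root f (λ ()) ys)

  Ground : ∀ {τ} → ThTerm τ → Set
  Ground r = ∀ {τ′} (x : VTh τ′) → ¬ Occ x r

  Ground* : ∀ {as} → ThArgs as → Set
  Ground* rs = ∀ {τ′} (x : VTh τ′) → ¬ OccArgs x rs

  mutual
    calculate-ground : ∀ {τ} (ρ : Valuation) (r : ThTerm τ) → Ground r → ⌜ r ⌝ ↔*calc ⌞ ⟦ r ⟧ ρ ⌟
    calculate-ground ρ (var x)    r-ground = ⊥-elim (r-ground x here)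
    calculate-ground ρ (app f rs) r-ground =
      th-cong f (calculate-ground* ρ rs (λ x o → r-ground x (arg o))) ◅◅ calculate f (⟦ rs ⟧* ρ)

    calculate-ground* : ∀ {as} (ρ : Valuation) (rs : ThArgs as) → Ground* rs →
                        Star _↔calcᵗ_ ⌜ rs ⌝* ⌞ ⟦ rs ⟧* ρ ⌟*
    calculate-ground* ρ []       _         = ε
    calculate-ground* ρ (r ∷ rs) rs-ground =
      ∷-congˡ ⌜ rs ⌝* (calculate-ground ρ r (λ x o → rs-ground x (head o)))
      ◅◅ ∷-congʳ ⌞ ⟦ r ⟧ ρ ⌟ (calculate-ground* ρ rs (λ x o → rs-ground x (tail o)))

  ground-convertible : ∀ {τ} {s t : ThTerm τ} (ρ : Valuation) → Ground s → Ground t →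
                       ⟦ s ⟧ ρ ≡ ⟦ t ⟧ ρ → ⌜ s ⌝ ↔*calc ⌜ t ⌝
  ground-convertible {s = s} {t} ρ s-ground t-ground s≐t =
    calculate-ground ρ s s-ground
    ◅◅ subst (λ y → ⌞ y ⌟ ↔*calc ⌜ t ⌝) (sym s≐t) (reverse swap (calculate-ground ρ t t-ground))

  module _ {X : VSet} {σ : Subst} (σ-valued : X Valued σ) where
    mutual
      instance-ground : ∀ {τ} (s : ThTerm τ) → s ⊆V X →
                        (r : ThTerm τ) → ⌜ r ⌝ ≡ ⌜ s ⌝ ⟨ σ ⟩ → Ground r
      instance-ground (var x) s⊆X r ⌜r⌝≡σx with proj₂ (σ-valued x (s⊆X x here))
      ... | c , _ , σx≡c with ⌜⌝≡th⇒app r (trans ⌜r⌝≡σx σx≡c)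
      ... | [] , refl , _ = λ { _ (arg ()) }
      instance-ground (app f ss) s⊆X r ⌜r⌝≡sσ with ⌜⌝≡th⇒app r ⌜r⌝≡sσ
      ... | rs , refl , ⌜rs⌝≡ssσ = λ { y (arg o) →
        instance-ground* ss (λ x o′ → s⊆X x (arg o′)) rs ⌜rs⌝≡ssσ y o }

      instance-ground* : ∀ {as} (ss : ThArgs as) → (∀ {τ′} (x : VTh τ′) → OccArgs x ss → X x) →
                         (rs : ThArgs as) → ⌜ rs ⌝* ≡ ⌜ ss ⌝* ⟨ σ ⟩ᵗ → Ground* rs
      instance-ground* (s ∷ ss) ss⊆X (r ∷ rs) eq y (head o) =
        instance-ground s (λ x o′ → ss⊆X x (head o′)) r (proj₁ (∷-injective eq)) y o
      instance-ground* (s ∷ ss) ss⊆X (r ∷ rs) eq y (tail o) =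
        instance-ground* ss (λ x o′ → ss⊆X x (tail o′)) rs (proj₂ (∷-injective eq)) y o

lemma18 : (S : Signature) (M : Model S) → let open Th M in
          (E : CE → Set) (X : VSet) {τ : STh} (s t : ThTerm τ) (φ : Constraint) →
          s ⊆V X → t ⊆V X → (φ⊆X : φ ⊆V X) →
          (∀ (σ : Subst) → X Valued σ →
             ⊨ ((⌜ φ ⌝ ⟨ σ ⟩) ⇒ₜ ((⌜ s ⌝ ⟨ σ ⟩) =ₜ (⌜ t ⌝ ⟨ σ ⟩)))) →
          E ⊨cec (Π X ∙ ⌜ s ⌝ ≈ ⌜ t ⌝ [ φ ]⟨ φ⊆X ⟩)
lemma18 S M E X s t φ s⊆X t⊆X _ valid σ σ-valued ⊨φσ =
  let open Th M
      open CalculationLemmas M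
      s′ , t′ , ⌜s′⌝≡sσ , ⌜t′⌝≡tσ , s′≐t′ = ⊨-=-elim (⊨-⇒-elim (valid σ σ-valued) ⊨φσ)
  in subst₂ (λ u v → u ↔*[ E ] v) ⌜s′⌝≡sσ ⌜t′⌝≡tσ
       (Star.map inj₁ (ground-convertible someValuation
         (instance-ground σ-valued s s⊆X s′ ⌜s′⌝≡sσ)
         (instance-ground σ-valued t t⊆X t′ ⌜t′⌝≡tσ)
         (s′≐t′ someValuation)))
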